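{- Let $\mathcal{Q}^-$ be the labelled calculus with the rules $(\wedge_l),(\wedge_r),(\vee_l),(\vee_r),(\supset_r),(\exists_l),(id^*_q),(\neg_l),(\neg_r),(\supset^*_l),(\forall^*_r),(\forall^*_l),(\exists^*_r),(lift)$ (i.e. $\mathsf{G3IntQC}+\{(id^*_q),(\neg_l),(\neg_r),(\supset^*_l),(\forall^*_r),(\forall^*_l),(\exists^*_r),(lift)\}$ without $(id_q),(\bot_l),(\supset_l),(\forall_l),(\forall_r),(\exists_r),(ref),(tra),(nd),(cd)$). Every derivation in $\mathcal{Q}^-$ whose end sequent is $\Rightarrow w:A$ contains only treelike labelled sequents, and $w$ is the root of each sequent in the derivation.
   Context: First-order formulas built from atoms $p(\vec{a})$ and $\bot$ by $\wedge,\vee,\supset,\neg,\forall x,\exists x$; bound variables are distinct from parameters $a,b,\dots$ which replace free variables; $A[a/x]$: substitution of $a$ for free $x$; $p(\vec{a})$ with $\vec{a}=a_0,\dots,a_n$ all its parameters. Labelled sequents $\mathcal{R},\Gamma\Rightarrow\Delta$: $\mathcal{R}$ a multiset of relational atoms $w\le v$ and domain atoms $a\in D_w$, $\Gamma,\Delta$ multisets of labelled formulas $w:A$. A (not necessarily directed) path from $v$ to $w$ in $\mathcal{R}$ exists iff $v=w$ or there are labels $v=z_0,\dots,z_k=w$ with $z_i\le z_{i+1}$ or $z_{i+1}\le z_i$ in $\mathcal{R}$ for each $i$. Rules: $(\wedge_l)$: from $\mathcal{R},w:A,w:B,\Gamma\Rightarrow\Delta$ infer $\mathcal{R},w:A\wedge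 B,\Gamma\Rightarrow\Delta$; $(\wedge_r)$: from $\mathcal{R},\Gamma\Rightarrow\Delta,w:A$ and $\mathcal{R},\Gamma\Rightarrow\Delta,w:B$ infer $\mathcal{R},\Gamma\Rightarrow\Delta,w:A\wedge B$; $(\vee_l)$: from $\mathcal{R},w:A,\Gamma\Rightarrow\Delta$ and $\mathcal{R},w:B,\Gamma\Rightarrow\Delta$ infer $\mathcal{R},w:A\vee B,\Gamma\Rightarrow\Delta$; $(\vee_r)$: from $\mathcal{R},\Gamma\Rightarrow\Delta,w:A,w:B$ infer $\mathcal{R},\Gamma\Rightarrow\Delta,w:A\vee B$; $(\supset_r)$: from $\mathcal{R},w\le v,v:A,\Gamma\Rightarrow\Delta,v:B$ infer $\mathcal{R},\Gamma\Rightarrow\Delta,w:A\supset B$, $v$ not in the conclusion; $(\exists_l)$: from $\mathcal{R},a\in D_w,w:A[a/x],\Gamma\Rightarrow\Delta$ infer $\mathcal{R},w:\exists xA,\Gamma\Rightarrow\Delta$, $a$ not in the conclusion; $(id^*_q)$: $\mathcal{R},a_0\in D_{v_0},\dots,a_n\in D_{v_n},w:p(\vec{a}),\Gamma\Rightarrow w:p(\vec{a}),\Delta$, with a path from each $v_i$ to $w$ in $\mathcal{R}$; $(\neg_r)$: from $\mathcal{R},w\le v,v:A,\Gamma\Rightarrow\Delta$ infer $\mathcal{R},\Gamma\Rightarrow\Delta,w:\neg A$, $v$ not in the conclusion; $(\neg_l)$: from $\mathcal{R},w:\neg A,\Gamma\Rightarrow\Delta,w:A$ infer $\mathcal{R},w:\neg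 A,\Gamma\Rightarrow\Delta$; $(\supset^*_l)$: from $\mathcal{R},w:A\supset B,\Gamma\Rightarrow\Delta,w:A$ and $\mathcal{R},w:A\supset B,w:B,\Gamma\Rightarrow\Delta$ infer $\mathcal{R},w:A\supset B,\Gamma\Rightarrow\Delta$; $(\forall^*_r)$: from $\mathcal{R},a\in D_w,\Gamma\Rightarrow w:A[a/x],\Delta$ infer $\mathcal{R},\Gamma\Rightarrow w:\forall xA,\Delta$, $a$ not in the conclusion; $(\forall^*_l)$: from $\mathcal{R},a\in D_v,w:A[a/x],w:\forall xA,\Gamma\Rightarrow\Delta$ infer $\mathcal{R},a\in D_v,w:\forall xA,\Gamma\Rightarrow\Delta$, provided a path from $v$ to $w$ in $\mathcal{R}$; $(\exists^*_r)$: from $\mathcal{R},a\in D_v,\Gamma\Rightarrow\Delta,w:A[a/x],w:\exists xA$ infer $\mathcal{R},a\in D_v,\Gamma\Rightarrow\Delta,w:\exists xA$, provided a path from $v$ to $w$ in $\mathcal{R}$; $(lift)$: from $\mathcal{R},w\le u,w:A,u:A,\Gamma\Rightarrow\Delta$ infer $\mathcal{R},w\le u,w:A,\Gamma\Rightarrow\Delta$. The graph of a labelled sequent $\Lambda$ has as vertices the labels occurring in $\Lambda$ (in labelled formulas, relational atoms or domain atoms) and a directed edge $(w,v)$ iff $w\le v$ occurs in $\Lambda$. $\Lambda$ is treelike iff there is a unique vertex $w$, the root, such that for every other vertex $v$ there is a unique directed path from $w$ to $v$. -}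

module Defs where

open import Data.Nat using (ℕ; _≟_)
open import Data.List using (List; []; _∷_; _++_; concatMap)
open import Data.List.Membership.Propositional using (_∈_; _∉_)
open import Data.List.Relation.Binary.Permutation.Propositional using (_↭_)
open import Data.List.Relation.Unary.All using (All)
open import Data.Product using (Σ; _×_; ∃; ∃-syntax)
open import Relation.Binary.PropositionalEquality using (_≡_; _≢_)
open import Relation.Nullary using (yes; no)

Label : Set
Label = ℕ

Param : Set
Param = ℕ

Var : Set
Var = ℕ

Pred : Set
Pred = ℕ

data Term : Set where
  var : Var → Term
  par : Param → Term

infixr 6 _∧f_
infixr 5 _∨f_
infixr 4 _⊃f_

data Formula : Set where
  atom  : Pred → List Term → Formula
  ⊥f    : Formula
  _∧f_  : Formula → Formula → Formula
  _∨f_  : Formula → Formula → Formula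
  _⊃f_  : Formula → Formula → Formula
  ¬f    : Formula → Formula
  ∀f    : Var → Formula → Formula
  ∃f    : Var → Formula → Formula

substTerm : Term → Param → Var → Term
substTerm (var y) a x with x ≟ y
... | yes _ = par a
... | no  _ = var y
substTerm (par b) a x = par b

substTerms : List Term → Param → Var → List Term
substTerms []       a x = []
substTerms (t ∷ ts) a x = substTerm t a x ∷ substTerms ts a x

_[_/_] : Formula → Param → Var → Formula
atom p ts [ a / x ] = atom p (substTerms ts a x)
⊥f        [ a / x ] = ⊥f
(A ∧f B)  [ a / x ] = (A [ a / x ]) ∧f (B [ a / x ])
(A ∨f B)  [ a / x ] = (A [ a / x ]) ∨f (B [ a / x ])
(A ⊃f B)  [ a / x ] = (A [ a / x ]) ⊃f (B [ a / x ])
¬f A      [ a / x ] = ¬f (A [ a / x ])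
∀f y A    [ a / x ] with x ≟ y
... | yes _ = ∀f y A
... | no  _ = ∀f y (A [ a / x ])
∃f y A    [ a / x ] with x ≟ y
... | yes _ = ∃f y A
... | no  _ = ∃f y (A [ a / x ])

paramsTerms : List Term → List Param
paramsTerms []            = []
paramsTerms (var _ ∷ ts)  = paramsTerms ts
paramsTerms (par a ∷ ts)  = a ∷ paramsTerms ts

paramsF : Formula → List Param
paramsF (atom p ts) = paramsTerms ts
paramsF ⊥f          = []
paramsF (A ∧f B)    = paramsF A ++ paramsF B
paramsF (A ∨f B)    = paramsF A ++ paramsF B
paramsF (A ⊃f B)    = paramsF A ++ paramsF B
paramsF (¬f A)      = paramsF A
paramsF (∀f _ A)    = paramsF A
paramsF (∃f _ A)    = paramsF A

data RAtom : Set where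
  _≤r_ : Label → Label → RAtom
  _∈D_ : Param → Label → RAtom

infix 3 _∶_
record LFormula : Set where
  constructor _∶_
  field
    lab  : Label
    form : Formula

-- R, Γ ⇒ Δ  (multisets represented by lists, taken up to permutation)
infix 2 ⟨_∣_⇒_⟩
record Sequent : Set where
  constructor ⟨_∣_⇒_⟩
  field
    rel : List RAtom
    ant : List LFormula
    suc : List LFormula
open Sequent public

infix 1 _≅_
_≅_ : Sequent → Sequent → Set
S ≅ T = (rel S ↭ rel T) × (ant S ↭ ant T) × (suc S ↭ suc T)

labelsR : RAtom → List Label
labelsR (w ≤r v) = w ∷ v ∷ []
labelsR (a ∈D w) = w ∷ []

paramsR : RAtom → List Param
paramsR (w ≤r v) = []
paramsR (a ∈D w) = a ∷ []

labelsL : LFormula → List Label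
labelsL (w ∶ A) = w ∷ []

paramsL : LFormula → List Param
paramsL (w ∶ A) = paramsF A

labels : Sequent → List Label
labels S = concatMap labelsR (rel S) ++ concatMap labelsL (ant S) ++ concatMap labelsL (suc S)

params : Sequent → List Param
params S = concatMap paramsR (rel S) ++ concatMap paramsL (ant S) ++ concatMap paramsL (suc S)

data Conn (R : List RAtom) : Label → Label → Set where
  here : ∀ {v} → Conn R v v
  fwd  : ∀ {z z' w} → (z ≤r z') ∈ R → Conn R z' w → Conn R z w
  bwd  : ∀ {z z' w} → (z' ≤r z) ∈ R → Conn R z' w → Conn R z w

IdCond : List RAtom → Label → List Term → Set
IdCond R w ts = All (λ t → Σ Param λ a → (t ≡ par a) × Σ Label λ v → ((a ∈D v) ∈ R) × Conn R v w) ts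

-- The calculus Q⁻ ; each rule's conclusion is any sequent equal (as
-- multisets) to the displayed one.

data Der : Sequent → Set where
  ∧l : ∀ {S} R Γ Δ w A B → S ≅ ⟨ R ∣ (w ∶ A ∧f B) ∷ Γ ⇒ Δ ⟩ →
       Der ⟨ R ∣ (w ∶ A) ∷ (w ∶ B) ∷ Γ ⇒ Δ ⟩ → Der S
  ∧r : ∀ {S} R Γ Δ w A B → S ≅ ⟨ R ∣ Γ ⇒ (w ∶ A ∧f B) ∷ Δ ⟩ →
       Der ⟨ R ∣ Γ ⇒ (w ∶ A) ∷ Δ ⟩ → Der ⟨ R ∣ Γ ⇒ (w ∶ B) ∷ Δ ⟩ → Der S
  ∨l : ∀ {S} R Γ Δ w A B → S ≅ ⟨ R ∣ (w ∶ A ∨f B) ∷ Γ ⇒ Δ ⟩ →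
       Der ⟨ R ∣ (w ∶ A) ∷ Γ ⇒ Δ ⟩ → Der ⟨ R ∣ (w ∶ B) ∷ Γ ⇒ Δ ⟩ → Der S
  ∨r : ∀ {S} R Γ Δ w A B → S ≅ ⟨ R ∣ Γ ⇒ (w ∶ A ∨f B) ∷ Δ ⟩ →
       Der ⟨ R ∣ Γ ⇒ (w ∶ A) ∷ (w ∶ B) ∷ Δ ⟩ → Der S
  ⊃r : ∀ {S} R Γ Δ w v A B → S ≅ ⟨ R ∣ Γ ⇒ (w ∶ A ⊃f B) ∷ Δ ⟩ → v ∉ labels S →
       Der ⟨ (w ≤r v) ∷ R ∣ (v ∶ A) ∷ Γ ⇒ (v ∶ B) ∷ Δ ⟩ → Der S
  ∃l : ∀ {S} R Γ Δ w x a A → S ≅ ⟨ R ∣ (w ∶ ∃f x A) ∷ Γ ⇒ Δ ⟩ → a ∉ params S →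
       Der ⟨ (a ∈D w) ∷ R ∣ (w ∶ A [ a / x ]) ∷ Γ ⇒ Δ ⟩ → Der S
  id*q : ∀ {S} R Γ Δ w p ts → S ≅ ⟨ R ∣ (w ∶ atom p ts) ∷ Γ ⇒ (w ∶ atom p ts) ∷ Δ ⟩ →
       IdCond R w ts → Der S
  ¬r : ∀ {S} R Γ Δ w v A → S ≅ ⟨ R ∣ Γ ⇒ (w ∶ ¬f A) ∷ Δ ⟩ → v ∉ labels S →
       Der ⟨ (w ≤r v) ∷ R ∣ (v ∶ A) ∷ Γ ⇒ Δ ⟩ → Der S
  ¬l : ∀ {S} R Γ Δ w A → S ≅ ⟨ R ∣ (w ∶ ¬f A) ∷ Γ ⇒ Δ ⟩ →
       Der ⟨ R ∣ (w ∶ ¬f A) ∷ Γ ⇒ (w ∶ A) ∷ Δ ⟩ → Der S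
  ⊃*l : ∀ {S} R Γ Δ w A B → S ≅ ⟨ R ∣ (w ∶ A ⊃f B) ∷ Γ ⇒ Δ ⟩ →
       Der ⟨ R ∣ (w ∶ A ⊃f B) ∷ Γ ⇒ (w ∶ A) ∷ Δ ⟩ →
       Der ⟨ R ∣ (w ∶ A ⊃f B) ∷ (w ∶ B) ∷ Γ ⇒ Δ ⟩ → Der S
  ∀*r : ∀ {S} R Γ Δ w x a A → S ≅ ⟨ R ∣ Γ ⇒ (w ∶ ∀f x A) ∷ Δ ⟩ → a ∉ params S →
       Der ⟨ (a ∈D w) ∷ R ∣ Γ ⇒ (w ∶ A [ a / x ]) ∷ Δ ⟩ → Der S
  ∀*l : ∀ {S} R Γ Δ w v x a A → S ≅ ⟨ (a ∈D v) ∷ R ∣ (w ∶ ∀f x A) ∷ Γ ⇒ Δ ⟩ →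
       Conn R v w →
       Der ⟨ (a ∈D v) ∷ R ∣ (w ∶ A [ a / x ]) ∷ (w ∶ ∀f x A) ∷ Γ ⇒ Δ ⟩ → Der S
  ∃*r : ∀ {S} R Γ Δ w v x a A → S ≅ ⟨ (a ∈D v) ∷ R ∣ Γ ⇒ (w ∶ ∃f x A) ∷ Δ ⟩ →
       Conn R v w →
       Der ⟨ (a ∈D v) ∷ R ∣ Γ ⇒ (w ∶ A [ a / x ]) ∷ (w ∶ ∃f x A) ∷ Δ ⟩ → Der S
  lift : ∀ {S} R Γ Δ w u A → S ≅ ⟨ (w ≤r u) ∷ R ∣ (w ∶ A) ∷ Γ ⇒ Δ ⟩ →
       Der ⟨ (w ≤r u) ∷ R ∣ (w ∶ A) ∷ (u ∶ A) ∷ Γ ⇒ Δ ⟩ → Der S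

Every : (Sequent → Set) → ∀ {S} → Der S → Set
Every P {S} (∧l _ _ _ _ _ _ _ d)        = P S × Every P d
Every P {S} (∧r _ _ _ _ _ _ _ d e)      = P S × Every P d × Every P e
Every P {S} (∨l _ _ _ _ _ _ _ d e)      = P S × Every P d × Every P e
Every P {S} (∨r _ _ _ _ _ _ _ d)        = P S × Every P d
Every P {S} (⊃r _ _ _ _ _ _ _ _ _ d)    = P S × Every P d
Every P {S} (∃l _ _ _ _ _ _ _ _ _ d)    = P S × Every P d
Every P {S} (id*q _ _ _ _ _ _ _ _)      = P S
Every P {S} (¬r _ _ _ _ _ _ _ _ d)      = P S × Every P d
Every P {S} (¬l _ _ _ _ _ _ d)          = P S × Every P d
Every P {S} (⊃*l _ _ _ _ _ _ _ d e)     = P S × Every P d × Every P e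
Every P {S} (∀*r _ _ _ _ _ _ _ _ _ d)   = P S × Every P d
Every P {S} (∀*l _ _ _ _ _ _ _ _ _ _ d) = P S × Every P d
Every P {S} (∃*r _ _ _ _ _ _ _ _ _ _ d) = P S × Every P d
Every P {S} (lift _ _ _ _ _ _ _ d)      = P S × Every P d

-- directed path in the graph of R (edge (w,v) iff w ≤ v occurs in R),
-- indexed by its list of vertices
data DPath (R : List RAtom) : Label → Label → List Label → Set where
  stop : ∀ {v} → DPath R v v (v ∷ [])
  step : ∀ {w u v vs} → (w ≤r u) ∈ R → DPath R u v vs → DPath R w v (w ∷ vs)

UniquePath : List RAtom → Label → Label → Set
UniquePath R w v = Σ (List Label) λ vs → DPath R w v vs × (∀ vs' → DPath R w v vs' → vs' ≡ vs)

IsRootCand : Sequent → Label → Set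
IsRootCand S w = (w ∈ labels S) × (∀ v → v ∈ labels S → v ≢ w → UniquePath (rel S) w v)

Treelike : Sequent → Set
Treelike S = ∃[ w ] (IsRootCand S w × (∀ w' → IsRootCand S w' → w' ≡ w))

TreelikeWithRoot : Label → Sequent → Set
TreelikeWithRoot w S = Treelike S × IsRootCand S w

-- Invariant: the root w occurs in the sequent and reaches each of its labels by exactly one
-- directed path. This makes the sequent treelike with root w, since a second root candidate
-- would close a nontrivial cycle through w. The invariant holds for ⇒ w:A and passes to
-- premises: apart from (⊃r) and (¬r), every rule keeps the edges and only adds formulas or
-- domain atoms at labels already present, while (⊃r) and (¬r) attach a fresh label v as a
-- new leaf below the principal label.
module Submission where

open import Defs
open import Data.List using (List; []; _∷_; _++_; concatMap)
open import Data.List.Properties using (∷-injectiveʳ)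
open import Data.List.Membership.Propositional using (_∈_; _∉_)
open import Data.List.Membership.Propositional.Properties using (∈-++⁺ˡ; ∈-++⁺ʳ)
open import Data.List.Relation.Unary.Any using (here; there)
open import Data.List.Relation.Binary.Subset.Propositional using (_⊆_)
open import Data.List.Relation.Binary.Subset.Propositional.Properties
  using (⊆-refl; ⊆-trans; ⊆-reflexive-↭; xs⊆x∷xs; ∈-∷⁺ʳ; ++⁺; concatMap⁺)
open import Data.List.Relation.Binary.Permutation.Propositional
  using (_↭_; ↭-refl; ↭-sym; ↭-trans; swap)
open import Data.List.Relation.Binary.Permutation.Propositional.Properties
  using (∈-resp-↭; shift; ++⁺ˡ)
open import Data.Product using (Σ; _×_; _,_; proj₁; proj₂; ∃)
open import Data.Empty using (⊥-elim)
open import Data.Nat using (_≟_)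
open import Function using (_∘_)
open import Relation.Nullary using (yes; no; ¬_)
open import Relation.Binary.PropositionalEquality using (_≡_; _≢_; refl; sym; trans; cong; subst)

private
  variable
    R R' : List RAtom
    V V' xs ys : List Label
    a b c r u v x y : Label

_⊆ₑ_ : List RAtom → List RAtom → Set
R ⊆ₑ R' = ∀ {x y} → (x ≤r y) ∈ R → (x ≤r y) ∈ R'

dpath-mono : R ⊆ₑ R' → DPath R a b xs → DPath R' a b xs
dpath-mono R⊆R' stop       = stop
dpath-mono R⊆R' (step e p) = step (R⊆R' e) (dpath-mono R⊆R' p)

dpath-join : DPath R a b xs → DPath R b c ys → ∃ (DPath R a c)
dpath-join stop       q = _ , q
dpath-join (step e p) q = _ , step e (proj₂ (dpath-join p q))

dpath-snoc : DPath R a b xs → (b ≤r c) ∈ R → DPath R a c (xs ++ c ∷ [])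
dpath-snoc stop       e = step e stop
dpath-snoc (step e p) e′ = step e (dpath-snoc p e′)

uniquePath-resp : R ⊆ₑ R' → R' ⊆ₑ R → UniquePath R r v → UniquePath R' r v
uniquePath-resp R⊆R' R'⊆R (vs , p , only) =
  vs , dpath-mono R⊆R' p , λ vs' p' → only vs' (dpath-mono R'⊆R p')

uniquePath-acyclic : UniquePath R r r → DPath R r x xs → DPath R x r ys → x ≡ r
uniquePath-acyclic _ stop _ = refl
uniquePath-acyclic {R = R} (_ , _ , only) (step e p) q with dpath-join p q
... | zs , pq = ⊥-elim (no-empty (subst (DPath R _ _) (∷-injectiveʳ loop≡stop) pq))
  where
  loop≡stop : _ ∷ zs ≡ _ ∷ []
  loop≡stop = trans (only _ (step e pq)) (sym (only _ stop))
  no-empty : ∀ {a b} → ¬ DPath R a b []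
  no-empty ()

record RootedAt (R : List RAtom) (V : List Label) (r : Label) : Set where
  field
    root∈  : r ∈ V
    unique : ∀ {v} → v ∈ V → UniquePath R r v
open RootedAt

rootedAt-singleton : RootedAt [] (r ∷ []) r
rootedAt-singleton {r} = record { root∈ = here refl ; unique = λ { (here refl) → trivial } }
  where
  trivial : UniquePath [] r r
  trivial = r ∷ [] , stop , λ { _ stop → refl ; _ (step () _) }

rootedAt-edges : R ⊆ₑ R' → R' ⊆ₑ R → RootedAt R V r → RootedAt R' V r
rootedAt-edges R⊆R' R'⊆R ρ = record
  { root∈ = root∈ ρ ; unique = uniquePath-resp R⊆R' R'⊆R ∘ unique ρ }

rootedAt-vertices : V ⊆ V' → V' ⊆ V → RootedAt R V r → RootedAt R V' r
rootedAt-vertices V⊆V' V'⊆V ρ = record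
  { root∈ = V⊆V' (root∈ ρ) ; unique = unique ρ ∘ V'⊆V }

rootedAt-insert : x ∈ V → V' ↭ x ∷ V → RootedAt R V r → RootedAt R V' r
rootedAt-insert x∈V V'↭ = rootedAt-vertices
  (⊆-trans (xs⊆x∷xs _ _) (⊆-reflexive-↭ (↭-sym V'↭)))
  (⊆-trans (⊆-reflexive-↭ V'↭) (∈-∷⁺ʳ x∈V ⊆-refl))

rootedAt-delete : x ∈ V' → V ↭ x ∷ V' → RootedAt R V r → RootedAt R V' r
rootedAt-delete x∈V' V↭ = rootedAt-vertices
  (⊆-trans (⊆-reflexive-↭ V↭) (∈-∷⁺ʳ x∈V' ⊆-refl))
  (⊆-trans (xs⊆x∷xs _ _) (⊆-reflexive-↭ (↭-sym V↭)))

rootedAt-domain : ∀ {p} → u ∈ V → RootedAt R V r → RootedAt ((p ∈D u) ∷ R) (u ∷ V) r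
rootedAt-domain u∈V = rootedAt-insert u∈V ↭-refl ∘ rootedAt-edges there λ { (here ()) ; (there e) → e }

module _ {R : List RAtom} {V : List Label} {u v : Label}
         (endpoints∈ : ∀ {x y} → (x ≤r y) ∈ R → x ∈ V × y ∈ V)
         (u∈V : u ∈ V) (v∉V : v ∉ V) where

  private
    R⁺ : List RAtom
    R⁺ = (u ≤r v) ∷ R

    ∈V⇒≢v : x ∈ V → x ≢ v
    ∈V⇒≢v x∈V refl = v∉V x∈V

    -- no edge leaves v: u ≠ v, and every edge of R starts in V
    from-v : DPath R⁺ v y xs → y ≡ v × xs ≡ v ∷ []
    from-v stop                 = refl , refl
    from-v (step (here refl) _) = ⊥-elim (∈V⇒≢v u∈V refl)
    from-v (step (there e) _)   = ⊥-elim (v∉V (proj₁ (endpoints∈ e)))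

    avoid-v : DPath R⁺ x y xs → y ≢ v → DPath R x y xs
    avoid-v stop                 _   = stop
    avoid-v (step (here refl) p) y≢v = ⊥-elim (y≢v (proj₁ (from-v p)))
    avoid-v (step (there e) p)   y≢v = step e (avoid-v p y≢v)

    via-u : DPath R⁺ x v xs → x ≢ v → Σ (List Label) λ xs₀ → DPath R x u xs₀ × xs ≡ xs₀ ++ v ∷ []
    via-u stop                 x≢v = ⊥-elim (x≢v refl)
    via-u (step (here refl) p) _   = u ∷ [] , stop , cong (u ∷_) (proj₂ (from-v p))
    via-u (step (there e) p)   _   with via-u p (∈V⇒≢v (proj₂ (endpoints∈ e)))
    ... | xs₀ , q , refl = _ , step e q , refl

  rootedAt-fresh : RootedAt R V r → RootedAt R⁺ (v ∷ V) r
  rootedAt-fresh {r} ρ = record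
    { root∈ = there (root∈ ρ) ; unique = λ { (here refl) → to-v ; (there y∈V) → to-old y∈V } }
    where
    to-old : y ∈ V → UniquePath R⁺ r y
    to-old y∈V with unique ρ y∈V
    ... | xs , p , only = xs , dpath-mono there p , λ xs' p' → only xs' (avoid-v p' (∈V⇒≢v y∈V))

    to-v : UniquePath R⁺ r v
    to-v with unique ρ u∈V
    ... | xs , p , only = xs ++ v ∷ [] , dpath-snoc (dpath-mono there p) (here refl) , λ xs' p' →
      let xs₀ , q , xs'≡ = via-u p' (∈V⇒≢v (root∈ ρ)) in trans xs'≡ (cong (_++ v ∷ []) (only xs₀ q))

Rooted : Label → Sequent → Set
Rooted r S = RootedAt (rel S) (labels S) r

rooted⇒treelikeWithRoot : ∀ {S} → Rooted r S → TreelikeWithRoot r S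
rooted⇒treelikeWithRoot {r} {S} ρ = (r , candidate , only-root) , candidate
  where
  candidate : IsRootCand S r
  candidate = root∈ ρ , λ v v∈ _ → unique ρ v∈

  only-root : ∀ r' → IsRootCand S r' → r' ≡ r
  only-root r' (r'∈ , unique') with r' ≟ r
  ... | yes r'≡r = r'≡r
  ... | no  r'≢r = uniquePath-acyclic (unique ρ (root∈ ρ))
    (proj₁ (proj₂ (unique ρ r'∈))) (proj₁ (proj₂ (unique' r (root∈ ρ) (r'≢r ∘ sym))))

labels-mono : ∀ {S T} → rel S ⊆ rel T → ant S ⊆ ant T → suc S ⊆ suc T → labels S ⊆ labels T
labels-mono R⊆ Γ⊆ Δ⊆ = ++⁺ (concatMap⁺ labelsR R⊆) (++⁺ (concatMap⁺ labelsL Γ⊆) (concatMap⁺ labelsL Δ⊆))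

≅-sym : ∀ {S T} → S ≅ T → T ≅ S
≅-sym (R↭ , Γ↭ , Δ↭) = ↭-sym R↭ , ↭-sym Γ↭ , ↭-sym Δ↭

≅⇒labels⊆ : ∀ {S T} → S ≅ T → labels S ⊆ labels T
≅⇒labels⊆ (R↭ , Γ↭ , Δ↭) = labels-mono (⊆-reflexive-↭ R↭) (⊆-reflexive-↭ Γ↭) (⊆-reflexive-↭ Δ↭)

rooted-resp-≅ : ∀ {S T} → S ≅ T → Rooted r S → Rooted r T
rooted-resp-≅ S≅T@(R↭ , _ , _) =
  rootedAt-vertices (≅⇒labels⊆ S≅T) (≅⇒labels⊆ (≅-sym S≅T))
  ∘ rootedAt-edges (∈-resp-↭ R↭) (∈-resp-↭ (↭-sym R↭))

endpoints∈labels : ∀ {S} → (x ≤r y) ∈ rel S → x ∈ labels S × y ∈ labels S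
endpoints∈labels {x} {y} {S} e = ∈-++⁺ˡ (edge (here refl)) , ∈-++⁺ˡ (edge (there (here refl)))
  where
  edge : labelsR (x ≤r y) ⊆ concatMap labelsR (rel S)
  edge = concatMap⁺ labelsR (∈-∷⁺ʳ {xs = []} e λ ())

relLabels : List RAtom → List Label
relLabels = concatMap labelsR

fmlLabels : List LFormula → List Label
fmlLabels = concatMap labelsL

∈-ant-head : ∀ R {w ys} → w ∈ relLabels R ++ w ∷ ys
∈-ant-head R = ∈-++⁺ʳ (relLabels R) (here refl)

∈-suc-head : ∀ R Γ {w ys} → w ∈ relLabels R ++ fmlLabels Γ ++ w ∷ ys
∈-suc-head R Γ = ∈-++⁺ʳ (relLabels R) (∈-++⁺ʳ (fmlLabels Γ) (here refl))

shift₂ : ∀ {z : Label} xs ys {zs} → xs ++ ys ++ z ∷ zs ↭ z ∷ xs ++ ys ++ zs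
shift₂ {z} xs ys = ↭-trans (++⁺ˡ xs (shift z ys _)) (shift z xs _)

-- Stated on label lists: a sequent's labels do not determine its formulas, which could then
-- not be inferred at the use sites.
rooted-addAnt : ∀ R {w ys} → w ∈ relLabels R ++ ys →
  RootedAt R (relLabels R ++ ys) r → RootedAt R (relLabels R ++ w ∷ ys) r
rooted-addAnt R w∈ = rootedAt-insert w∈ (shift _ (relLabels R) _)

rooted-addSuc : ∀ R Γ {w ys} → w ∈ relLabels R ++ fmlLabels Γ ++ ys →
  RootedAt R (relLabels R ++ fmlLabels Γ ++ ys) r → RootedAt R (relLabels R ++ fmlLabels Γ ++ w ∷ ys) r
rooted-addSuc R Γ w∈ = rootedAt-insert w∈ (shift₂ (relLabels R) (fmlLabels Γ))

rooted-newWorld : ∀ R Γ Δ w v (F A : Formula) → v ∉ labels ⟨ R ∣ Γ ⇒ (w ∶ F) ∷ Δ ⟩ →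
  Rooted r ⟨ R ∣ Γ ⇒ (w ∶ F) ∷ Δ ⟩ → Rooted r ⟨ (w ≤r v) ∷ R ∣ (v ∶ A) ∷ Γ ⇒ Δ ⟩
rooted-newWorld {r} R Γ Δ w v F A v∉ ρ = rooted-addAnt R⁺ (there (here refl)) without-w∶F
  where
  C : Sequent
  C = ⟨ R ∣ Γ ⇒ (w ∶ F) ∷ Δ ⟩

  R⁺ : List RAtom
  R⁺ = (w ≤r v) ∷ R

  w∈C : w ∈ labels C
  w∈C = ∈-suc-head R Γ

  with-edge : Rooted r ⟨ R⁺ ∣ Γ ⇒ (w ∶ F) ∷ Δ ⟩
  with-edge = rootedAt-insert (there w∈C) ↭-refl (rootedAt-fresh (endpoints∈labels {S = C}) w∈C v∉ ρ)

  without-w∶F : Rooted r ⟨ R⁺ ∣ Γ ⇒ Δ ⟩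
  without-w∶F = rootedAt-delete (here refl) (shift₂ (relLabels R⁺) (fmlLabels Γ)) with-edge

rooted⇒everyTreelike : ∀ {S} (d : Der S) → Rooted r S → Every (TreelikeWithRoot r) d
rooted⇒everyTreelike {S = S} (∧l R Γ Δ w A B S≅ d) ρ = rooted⇒treelikeWithRoot {S = S} ρ ,
  rooted⇒everyTreelike d (rooted-addAnt R (∈-ant-head R) (rooted-resp-≅ S≅ ρ))
rooted⇒everyTreelike {S = S} (∧r R Γ Δ w A B S≅ d e) ρ = rooted⇒treelikeWithRoot {S = S} ρ ,
  rooted⇒everyTreelike d (rooted-resp-≅ S≅ ρ) , rooted⇒everyTreelike e (rooted-resp-≅ S≅ ρ)
rooted⇒everyTreelike {S = S} (∨l R Γ Δ w A B S≅ d e) ρ = rooted⇒treelikeWithRoot {S = S} ρ ,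
  rooted⇒everyTreelike d (rooted-resp-≅ S≅ ρ) , rooted⇒everyTreelike e (rooted-resp-≅ S≅ ρ)
rooted⇒everyTreelike {S = S} (∨r R Γ Δ w A B S≅ d) ρ = rooted⇒treelikeWithRoot {S = S} ρ ,
  rooted⇒everyTreelike d (rooted-addSuc R Γ (∈-suc-head R Γ) (rooted-resp-≅ S≅ ρ))
rooted⇒everyTreelike {S = S} (⊃r R Γ Δ w v A B S≅ v∉ d) ρ = rooted⇒treelikeWithRoot {S = S} ρ ,
  rooted⇒everyTreelike d (rooted-addSuc ((w ≤r v) ∷ R) ((v ∶ A) ∷ Γ) (there (here refl))
    (rooted-newWorld R Γ Δ w v (A ⊃f B) A (v∉ ∘ ≅⇒labels⊆ (≅-sym S≅)) (rooted-resp-≅ S≅ ρ)))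
rooted⇒everyTreelike {S = S} (∃l R Γ Δ w x a A S≅ _ d) ρ = rooted⇒treelikeWithRoot {S = S} ρ ,
  rooted⇒everyTreelike d (rootedAt-domain (∈-ant-head R) (rooted-resp-≅ S≅ ρ))
rooted⇒everyTreelike {S = S} (id*q R Γ Δ w p ts S≅ _) ρ = rooted⇒treelikeWithRoot {S = S} ρ
rooted⇒everyTreelike {S = S} (¬r R Γ Δ w v A S≅ v∉ d) ρ = rooted⇒treelikeWithRoot {S = S} ρ ,
  rooted⇒everyTreelike d (rooted-newWorld R Γ Δ w v (¬f A) A (v∉ ∘ ≅⇒labels⊆ (≅-sym S≅)) (rooted-resp-≅ S≅ ρ))
rooted⇒everyTreelike {S = S} (¬l R Γ Δ w A S≅ d) ρ = rooted⇒treelikeWithRoot {S = S} ρ ,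
  rooted⇒everyTreelike d (rooted-addSuc R ((w ∶ ¬f A) ∷ Γ) (∈-ant-head R) (rooted-resp-≅ S≅ ρ))
rooted⇒everyTreelike {S = S} (⊃*l R Γ Δ w A B S≅ d e) ρ = rooted⇒treelikeWithRoot {S = S} ρ ,
  rooted⇒everyTreelike d (rooted-addSuc R ((w ∶ A ⊃f B) ∷ Γ) (∈-ant-head R) (rooted-resp-≅ S≅ ρ)) ,
  rooted⇒everyTreelike e (rooted-addAnt R (∈-ant-head R) (rooted-resp-≅ S≅ ρ))
rooted⇒everyTreelike {S = S} (∀*r R Γ Δ w x a A S≅ _ d) ρ = rooted⇒treelikeWithRoot {S = S} ρ ,
  rooted⇒everyTreelike d (rootedAt-domain (∈-suc-head R Γ) (rooted-resp-≅ S≅ ρ))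
rooted⇒everyTreelike {S = S} (∀*l R Γ Δ w v x a A S≅ _ d) ρ = rooted⇒treelikeWithRoot {S = S} ρ ,
  rooted⇒everyTreelike d (rooted-addAnt ((a ∈D v) ∷ R) (∈-ant-head ((a ∈D v) ∷ R)) (rooted-resp-≅ S≅ ρ))
rooted⇒everyTreelike {S = S} (∃*r R Γ Δ w v x a A S≅ _ d) ρ = rooted⇒treelikeWithRoot {S = S} ρ ,
  rooted⇒everyTreelike d (rooted-addSuc ((a ∈D v) ∷ R) Γ (∈-suc-head ((a ∈D v) ∷ R) Γ) (rooted-resp-≅ S≅ ρ))
rooted⇒everyTreelike {S = S} (lift R Γ Δ w u A S≅ d) ρ = rooted⇒treelikeWithRoot {S = S} ρ ,
  rooted⇒everyTreelike d (rootedAt-insert (there (here refl)) u∶A-added (rooted-resp-≅ S≅ ρ))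
  where
  R⁺ : List RAtom
  R⁺ = (w ≤r u) ∷ R
  u∶A-added : relLabels R⁺ ++ w ∷ u ∷ fmlLabels Γ ++ fmlLabels Δ ↭
              u ∷ relLabels R⁺ ++ w ∷ fmlLabels Γ ++ fmlLabels Δ
  u∶A-added = ↭-trans (++⁺ˡ (relLabels R⁺) (swap w u ↭-refl)) (shift u (relLabels R⁺) _)

theorem6 : ∀ (w : Label) (A : Formula) (d : Der ⟨ [] ∣ [] ⇒ (w ∶ A) ∷ [] ⟩) →
    Every (TreelikeWithRoot w) d
theorem6 w A d = rooted⇒everyTreelike d rootedAt-singleton
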